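{- Let $\pi$ be the set of tours of an optimal CVRP solution, of length $\mathrm{OPT}$. There is an absolute constant $C$ such that for every level $\ell$, $d_\ell\cdot E[c(\pi,\ell)]\le C\cdot\mathrm{OPT}$, where the expectation is over the random shifts of the dissection.
   Context: CVRP: given $n$ customer points and a depot in $\mathbb{R}^2$ and a capacity $k$, find tours from the depot each visiting at most $k$ customers, covering all customers, of minimum total length $\mathrm{OPT}$. Points lie in a bounding square of side $L$ (a power of 2) with integer coordinates. Random dissection: the bounding square (level 0) is recursively split into 4 equal squares by one horizontal and one vertical line until squares have side 1; squares and lines created at the $i$-th split have level $i$; level-$\ell$ squares have side $d_\ell=L/2^\ell$; the dissection is shifted by uniform random integers $a,b\in[0,L)$ (horizontal lines by $a$, vertical by $b$, modulo $L$). $c(\pi,\ell)=\sum_i c(\pi_i,\ell)$, where $c(\pi_i,\ell)$ is the number of times tour $\pi_i$ crosses the boundary of level-$\ell$ squares. -}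

module Defs where

open import Data.Nat using (ℕ; zero; suc; _+_; _*_; _∸_; _^_; _≤_; _<_; ∣_-_∣; _⊔_; _⊓_)
open import Data.Nat.Divisibility using (_∣?_)
open import Data.Fin using (Fin)
open import Data.List using (List; []; _∷_; _++_; map; concatMap; length; filter; applyUpTo; foldr)
open import Data.Nat.ListAction using (sum)
open import Data.List.Relation.Unary.All using (All)
open import Data.List.Relation.Unary.Any using (Any)
open import Data.List.Relation.Binary.Pointwise using (Pointwise)
open import Data.List.Membership.Propositional using (_∈_)
open import Data.Product using (Σ; Σ-syntax; _×_; _,_; proj₁; proj₂)
open import Data.Integer using (+_)
open import Data.Rational using (ℚ; 0ℚ; _/_) renaming (_≤_ to _≤ℚ_; _<_ to _<ℚ_; _+_ to _+ℚ_; _*_ to _*ℚ_)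

-- Exact comparison of sums of square roots of naturals (no reals in stdlib).
-- A "root sum" xs : List ℕ denotes the real number Σᵢ √(xs i).

RootSum : Set
RootSum = List ℕ

ℕ→ℚ : ℕ → ℚ
ℕ→ℚ a = (+ a) / 1

sumℚ : List ℚ → ℚ
sumℚ = foldr _+ℚ_ 0ℚ

UpperRoot : ℚ → ℕ → Set
UpperRoot r a = (0ℚ ≤ℚ r) × (ℕ→ℚ a ≤ℚ r *ℚ r)

LowerRoot : ℚ → ℕ → Set
LowerRoot p a = (0ℚ ≤ℚ p) × (p *ℚ p ≤ℚ ℕ→ℚ a)

-- Σ √xs ≤ Σ √ys, expressed exactly: for every ε > 0 there are rational
-- upper bounds of the √xᵢ and lower bounds of the √yⱼ whose sums differ by ≤ ε.
_≤√_ : RootSum → RootSum → Set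
xs ≤√ ys = (ε : ℚ) → 0ℚ <ℚ ε →
  Σ[ rs ∈ List ℚ ] Σ[ ps ∈ List ℚ ]
    (Pointwise UpperRoot rs xs × Pointwise LowerRoot ps ys × (sumℚ rs ≤ℚ sumℚ ps +ℚ ε))

Point : Set
Point = ℕ × ℕ

InSquare : ℕ → Point → Set
InSquare L (x , y) = (x < L) × (y < L)

sqDist : Point → Point → ℕ
sqDist (x₁ , y₁) (x₂ , y₂) = ∣ x₁ - x₂ ∣ * ∣ x₁ - x₂ ∣ + ∣ y₁ - y₂ ∣ * ∣ y₁ - y₂ ∣

edges : List Point → List (Point × Point)
edges []             = []
edges (p ∷ [])       = []
edges (p ∷ q ∷ rest) = (p , q) ∷ edges (q ∷ rest)

record Instance : Set where
  field
    m        : ℕ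
    n        : ℕ
    k        : ℕ
    depot    : Point
    customer : Fin n → Point

  L : ℕ
  L = 2 ^ m

open Instance public

WellFormed : Instance → Set
WellFormed I = InSquare (L I) (depot I) × ((i : Fin (n I)) → InSquare (L I) (customer I i))

-- a tour lists the customers it visits in order; it starts and ends at the depot
Tour : Instance → Set
Tour I = List (Fin (n I))

Solution : Instance → Set
Solution I = List (Tour I)

tourPath : (I : Instance) → Tour I → List Point
tourPath I t = depot I ∷ (map (customer I) t ++ (depot I ∷ []))

tourEdges : (I : Instance) → Tour I → List (Point × Point)
tourEdges I t = edges (tourPath I t)

Feasible : (I : Instance) → Solution I → Set
Feasible I π = All (λ t → length t ≤ k I) π × ((i : Fin (n I)) → Any (λ t → i ∈ t) π)

-- total length of a solution, as the root sum of its squared edge lengths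
lengthRS : (I : Instance) → Solution I → RootSum
lengthRS I π = concatMap (λ t → map (λ e → sqDist (proj₁ e) (proj₂ e)) (tourEdges I t)) π

Optimal : (I : Instance) → Solution I → Set
Optimal I π = Feasible I π × ((σ : Solution I) → Feasible I σ → lengthRS I π ≤√ lengthRS I σ)

side : Instance → ℕ → ℕ
side I ℓ = 2 ^ (m I ∸ ℓ)

-- number of integers t with lo < t ≤ hi and t ≡ s (mod d)
countLines : ℕ → ℕ → ℕ → ℕ → ℕ
countLines d s lo hi =
  length (filter (λ t → d ∣? ∣ t - s ∣) (applyUpTo (λ j → suc (lo + j)) (hi ∸ lo)))

-- crossings of the segment pq with the boundaries of level-ℓ squares of the
-- dissection shifted by (a , b): vertical lines x ≡ b, horizontal lines y ≡ a (mod d_ℓ)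
segCross : (d a b : ℕ) → Point → Point → ℕ
segCross d a b (x₁ , y₁) (x₂ , y₂) =
  countLines d b (x₁ ⊓ x₂) (x₁ ⊔ x₂) + countLines d a (y₁ ⊓ y₂) (y₁ ⊔ y₂)

crossings : (I : Instance) → Solution I → (ℓ a b : ℕ) → ℕ
crossings I π ℓ a b =
  sum (concatMap (λ t → map (λ e → segCross (side I ℓ) a b (proj₁ e) (proj₂ e)) (tourEdges I t)) π)

-- Σ_{a,b ∈ [0,L)} c(π, ℓ); E[c(π,ℓ)] = totalCrossings / L²
totalCrossings : (I : Instance) → Solution I → ℕ → ℕ
totalCrossings I π ℓ =
  sum (applyUpTo (λ a → sum (applyUpTo (λ b → crossings I π ℓ a b) (L I))) (L I))

module Submission where

-- Since E[c(π,ℓ)] = totalCrossings / L², the claim is d·totalCrossings ≤ C·L²·OPT.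
-- It holds for every solution π, optimal or not, with C = 2.  Write L = q·d for
-- the side d = d_ℓ of the level-ℓ squares and q = 2^ℓ.  A fixed integer t lies on a grid line x ≡ b (mod d) for at most
--     one shift b in each window of d consecutive shifts, hence for at most q of
--     the L shifts; so  d · Σ_b countLines d b lo hi ≤ L·(hi − lo).
--   * Per edge.  Summing over both shift coordinates, an edge e contributes
--     d · Σ_{a,b} segCross ≤ L² · |e|₁, where |e|₁ is its taxicab length;
--     summing over the edges of π gives  d · totalCrossings ≤ Σ_e L²·|e|₁.
--   * Root sums.  |e|₁² ≤ 4·|e|₂², so L²·|e|₁ ≤ √((2L²)²·|e|₂²); a natural number
--     bounded by a sum of such lower roots is bounded, as a root sum, by
--     Σ_e √((2L²)²·|e|₂²) = 2L²·OPT.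

open import Defs
open import Data.Nat using (ℕ; zero; suc; _+_; _*_; _∸_; _^_; _≤_; _<_; ∣_-_∣; _⊔_; _⊓_; z≤n; s≤s; _≤?_; >-nonZero)
open import Data.Nat.Properties
open import Data.Nat.Divisibility using (_∣_; _∣?_; ∣⇒≤; ∣m+n∣m⇒∣n; ∣m∣n⇒∣m+n; ∣1⇒≡1)
open import Data.Nat.ListAction using (sum)
open import Data.Nat.Tactic.RingSolver using (solve-∀)
open import Data.List using (List; []; _∷_; map; concatMap; length; filter; applyUpTo)
open import Data.List.Properties using (length-applyUpTo; map-concatMap; map-∘)
open import Data.List.Relation.Binary.Pointwise using (Pointwise; []; _∷_)
open import Data.Product using (Σ; _×_; _,_; proj₁; proj₂)
open import Data.Sum using (inj₁; inj₂)
open import Data.Empty using (⊥; ⊥-elim)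
open import Relation.Nullary using (yes; no)
open import Relation.Binary.PropositionalEquality
import Data.Integer as ℤ
import Data.Integer.Properties as ℤP
import Data.Rational as ℚ
import Data.Rational.Properties as ℚP
open import Data.Nat.Coprimality using (Coprime)

Sum : (ℕ → ℕ) → ℕ → ℕ
Sum f n = sum (applyUpTo f n)

Sum-cong : ∀ {f g} n → (∀ x → f x ≡ g x) → Sum f n ≡ Sum g n
Sum-cong zero    f≗g = refl
Sum-cong (suc n) f≗g = cong₂ _+_ (f≗g 0) (Sum-cong n (λ x → f≗g (suc x)))

Sum-zero : ∀ f n → (∀ j → j < n → f j ≡ 0) → Sum f n ≡ 0
Sum-zero f zero    f≡0 = refl
Sum-zero f (suc n) f≡0 rewrite f≡0 0 (s≤s z≤n) =
  Sum-zero (λ x → f (suc x)) n (λ j j<n → f≡0 (suc j) (s≤s j<n))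

Sum-+ : ∀ f g n → Sum (λ x → f x + g x) n ≡ Sum f n + Sum g n
Sum-+ f g zero    = refl
Sum-+ f g (suc n) rewrite Sum-+ (λ x → f (suc x)) (λ x → g (suc x)) n =
  interchange (f 0) (g 0) (Sum (λ x → f (suc x)) n) (Sum (λ x → g (suc x)) n)
  where
  interchange : ∀ a b c d → a + b + (c + d) ≡ a + c + (b + d)
  interchange = solve-∀

Sum-const : ∀ c n → Sum (λ _ → c) n ≡ n * c
Sum-const c zero    = refl
Sum-const c (suc n) = cong (c +_) (Sum-const c n)

Sum-* : ∀ k f n → Sum (λ x → k * f x) n ≡ k * Sum f n
Sum-* k f zero    = sym (*-zeroʳ k)
Sum-* k f (suc n) rewrite Sum-* k (λ x → f (suc x)) n = sym (*-distribˡ-+ k (f 0) _)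

Sum-split : ∀ f a b → Sum f (a + b) ≡ Sum f a + Sum (λ x → f (a + x)) b
Sum-split f zero    b = refl
Sum-split f (suc a) b rewrite Sum-split (λ x → f (suc x)) a b = sym (+-assoc (f 0) _ _)

Sum-sum : ∀ {B : Set} (g : ℕ → B → ℕ) E n →
  Sum (λ x → sum (map (g x) E)) n ≡ sum (map (λ e → Sum (λ x → g x e) n) E)
Sum-sum g []      n = Sum-zero _ n (λ _ _ → refl)
Sum-sum g (e ∷ E) n =
  trans (Sum-+ (λ x → g x e) (λ x → sum (map (g x) E)) n)
        (cong (Sum (λ x → g x e) n +_) (Sum-sum g E n))

Sum-≤1 : ∀ n (g : ℕ → ℕ) → (∀ j → g j ≤ 1) →
  (∀ i j → i < j → j < n → 1 ≤ g i → 1 ≤ g j → ⊥) → Sum g n ≤ 1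
Sum-≤1 zero    g g≤1 apart = z≤n
Sum-≤1 (suc n) g g≤1 apart with 1 ≤? g 0
... | no  g0≱1 rewrite n<1⇒n≡0 (≰⇒> g0≱1) =
  Sum-≤1 n (λ x → g (suc x)) (λ j → g≤1 (suc j))
    (λ i j i<j j<n → apart (suc i) (suc j) (s≤s i<j) (s≤s j<n))
... | yes g0≥1 = subst (λ s → g 0 + s ≤ 1) (sym (Sum-zero (λ x → g (suc x)) n laterZero))
                      (≤-trans (≤-reflexive (+-identityʳ (g 0))) (g≤1 0))
  where
  laterZero : ∀ j → j < n → g (suc j) ≡ 0
  laterZero j j<n with 1 ≤? g (suc j)
  ... | yes gj≥1 = ⊥-elim (apart 0 (suc j) (s≤s z≤n) (s≤s j<n) g0≥1 gj≥1)
  ... | no  gj≱1 = n<1⇒n≡0 (≰⇒> gj≱1)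

ind : ℕ → ℕ → ℕ
ind d x with d ∣? x
... | yes _ = 1
... | no  _ = 0

ind≤1 : ∀ d x → ind d x ≤ 1
ind≤1 d x with d ∣? x
... | yes _ = s≤s z≤n
... | no  _ = z≤n

ind-divides : ∀ d x → 1 ≤ ind d x → d ∣ x
ind-divides d x hit with d ∣? x
... | yes d∣x = d∣x
ind-divides d x () | no _

filter-length-∷ : ∀ d b t T → length (filter (λ s → d ∣? ∣ s - b ∣) (t ∷ T))
  ≡ ind d ∣ t - b ∣ + length (filter (λ s → d ∣? ∣ s - b ∣) T)
filter-length-∷ d b t T with d ∣? ∣ t - b ∣
... | yes _ = refl
... | no  _ = refl

∸-split : ∀ {a b c} → a ≤ b → b ≤ c → c ∸ a ≡ (b ∸ a) + (c ∸ b)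
∸-split {a} {b} {c} a≤b b≤c = begin
  c ∸ a           ≡⟨ cong (_∸ a) (sym (m∸n+n≡m b≤c)) ⟩
  (c ∸ b + b) ∸ a ≡⟨ +-∸-assoc (c ∸ b) a≤b ⟩
  c ∸ b + (b ∸ a) ≡⟨ +-comm (c ∸ b) (b ∸ a) ⟩
  b ∸ a + (c ∸ b) ∎
  where open ≡-Reasoning

gap-divisible : ∀ {d t u v} → u ≤ v → d ∣ ∣ t - u ∣ → d ∣ ∣ t - v ∣ → d ∣ v ∸ u
gap-divisible {d} {t} {u} {v} u≤v d∣tu d∣tv with ≤-total t u | ≤-total t v
... | inj₁ t≤u | _ =
  ∣m+n∣m⇒∣n (subst (d ∣_) (trans (m≤n⇒∣m-n∣≡n∸m (≤-trans t≤u u≤v)) (∸-split t≤u u≤v)) d∣tv)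
            (subst (d ∣_) (m≤n⇒∣m-n∣≡n∸m t≤u) d∣tu)
... | inj₂ u≤t | inj₁ t≤v =
  subst (d ∣_) (sym (∸-split u≤t t≤v))
        (∣m∣n⇒∣m+n (subst (d ∣_) (m≤n⇒∣n-m∣≡n∸m u≤t) d∣tu) (subst (d ∣_) (m≤n⇒∣m-n∣≡n∸m t≤v) d∣tv))
... | inj₂ u≤t | inj₂ v≤t =
  ∣m+n∣m⇒∣n (subst (d ∣_) (trans (m≤n⇒∣n-m∣≡n∸m u≤t) (trans (∸-split u≤v v≤t) (+-comm (v ∸ u) (t ∸ v)))) d∣tu)
            (subst (d ∣_) (m≤n⇒∣n-m∣≡n∸m v≤t) d∣tv)

hits-apart : ∀ {d t u v} → u < v → v < u + d → d ∣ ∣ t - u ∣ → d ∣ ∣ t - v ∣ → ⊥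
hits-apart {d} {t} {u} {v} u<v v<u+d d∣tu d∣tv = <-irrefl refl (<-≤-trans v<u+d u+d≤v)
  where
  d≤gap : d ≤ v ∸ u
  d≤gap = ∣⇒≤ {{>-nonZero (m<n⇒0<n∸m u<v)}} (gap-divisible {t = t} (<⇒≤ u<v) d∣tu d∣tv)
  u+d≤v : u + d ≤ v
  u+d≤v = ≤-trans (+-monoʳ-≤ u d≤gap) (≤-reflexive (m+[n∸m]≡n (<⇒≤ u<v)))

window-hits : ∀ d t c → Sum (λ j → ind d ∣ t - (c + j) ∣) d ≤ 1
window-hits d t c = Sum-≤1 d (λ j → ind d ∣ t - (c + j) ∣) (λ j → ind≤1 d _)
  (λ i j i<j j<d hit-i hit-j →
     hits-apart {t = t} (+-monoʳ-< c i<j) (<-≤-trans (+-monoʳ-< c j<d) (+-monoˡ-≤ d (m≤m+n c i)))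
                (ind-divides d _ hit-i) (ind-divides d _ hit-j))

windows-hits : ∀ d t q c → Sum (λ b → ind d ∣ t - (c + b) ∣) (q * d) ≤ q
windows-hits d t zero    c = z≤n
windows-hits d t (suc q) c = begin
  Sum hit (d + q * d)                                   ≡⟨ Sum-split hit d (q * d) ⟩
  Sum hit d + Sum (λ x → hit (d + x)) (q * d)           ≡⟨ cong (Sum hit d +_) (Sum-cong (q * d) shift) ⟩
  Sum hit d + Sum (λ x → ind d ∣ t - (c + d + x) ∣) (q * d) ≤⟨ +-mono-≤ (window-hits d t c) (windows-hits d t q (c + d)) ⟩
  suc q                                                 ∎
  where
  open ≤-Reasoning
  hit : ℕ → ℕ
  hit b = ind d ∣ t - (c + b) ∣
  shift : ∀ x → hit (d + x) ≡ ind d ∣ t - (c + d + x) ∣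
  shift x = cong (λ w → ind d ∣ t - w ∣) (sym (+-assoc c d x))

shift-hits : ∀ d q T → Sum (λ b → length (filter (λ s → d ∣? ∣ s - b ∣) T)) (q * d) ≤ q * length T
shift-hits d q []      = ≤-reflexive (trans (Sum-zero _ (q * d) (λ _ _ → refl)) (sym (*-zeroʳ q)))
shift-hits d q (t ∷ T) = begin
  Sum (λ b → length (filter (λ s → d ∣? ∣ s - b ∣) (t ∷ T))) (q * d)
    ≡⟨ Sum-cong (q * d) (λ b → filter-length-∷ d b t T) ⟩
  Sum (λ b → ind d ∣ t - b ∣ + length (filter (λ s → d ∣? ∣ s - b ∣) T)) (q * d)
    ≡⟨ Sum-+ (λ b → ind d ∣ t - b ∣) _ (q * d) ⟩
  Sum (λ b → ind d ∣ t - b ∣) (q * d) + Sum (λ b → length (filter (λ s → d ∣? ∣ s - b ∣) T)) (q * d)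
    ≤⟨ +-mono-≤ (windows-hits d t q 0) (shift-hits d q T) ⟩
  q + q * length T
    ≡⟨ sym (*-suc q (length T)) ⟩
  q * suc (length T) ∎
  where open ≤-Reasoning

∣-∣≡⊔∸⊓ : ∀ x y → ∣ x - y ∣ ≡ (x ⊔ y) ∸ (x ⊓ y)
∣-∣≡⊔∸⊓ x y with ≤-total x y
... | inj₁ x≤y rewrite m≤n⇒m⊔n≡n x≤y | m≤n⇒m⊓n≡m x≤y = m≤n⇒∣m-n∣≡n∸m x≤y
... | inj₂ y≤x rewrite m≥n⇒m⊔n≡m y≤x | m≥n⇒m⊓n≡n y≤x = m≤n⇒∣n-m∣≡n∸m y≤x

line-crossings : ∀ d q u v → d * Sum (λ b → countLines d b (u ⊓ v) (u ⊔ v)) (q * d) ≤ (q * d) * ∣ u - v ∣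
line-crossings d q u v = begin
  d * Sum (λ b → countLines d b (u ⊓ v) (u ⊔ v)) (q * d) ≤⟨ *-monoʳ-≤ d (shift-hits d q points) ⟩
  d * (q * length points)                              ≡⟨ cong (λ w → d * (q * w)) (length-applyUpTo _ (u ⊔ v ∸ u ⊓ v)) ⟩
  d * (q * (u ⊔ v ∸ u ⊓ v))                            ≡⟨ cong (λ w → d * (q * w)) (sym (∣-∣≡⊔∸⊓ u v)) ⟩
  d * (q * ∣ u - v ∣)                                  ≡⟨ reassoc d q ∣ u - v ∣ ⟩
  (q * d) * ∣ u - v ∣                                  ∎
  where
  open ≤-Reasoning
  points : List ℕ
  points = applyUpTo (λ j → suc (u ⊓ v + j)) (u ⊔ v ∸ u ⊓ v)
  reassoc : ∀ a b c → a * (b * c) ≡ (b * a) * c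
  reassoc = solve-∀

taxicab : Point × Point → ℕ
taxicab ((x₁ , y₁) , (x₂ , y₂)) = ∣ x₁ - x₂ ∣ + ∣ y₁ - y₂ ∣

edge-crossings : ∀ d q (e : Point × Point) →
  d * Sum (λ a → Sum (λ b → segCross d a b (proj₁ e) (proj₂ e)) (q * d)) (q * d)
    ≤ ((q * d) * (q * d)) * taxicab e
edge-crossings d q ((x₁ , y₁) , (x₂ , y₂)) = begin
  d * Sum (λ a → Sum (λ b → crossX b + crossY a) N) N
    ≡⟨ cong (d *_) (Sum-cong N (λ a → trans (Sum-+ crossX (λ _ → crossY a) N)
                                            (cong (Sum crossX N +_) (Sum-const (crossY a) N)))) ⟩
  d * Sum (λ a → Sum crossX N + N * crossY a) N
    ≡⟨ cong (d *_) (trans (Sum-+ (λ _ → Sum crossX N) (λ a → N * crossY a) N)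
                          (cong₂ _+_ (Sum-const (Sum crossX N) N) (Sum-* N crossY N))) ⟩
  d * (N * Sum crossX N + N * Sum crossY N)
    ≡⟨ distribute d N (Sum crossX N) (Sum crossY N) ⟩
  N * (d * Sum crossX N) + N * (d * Sum crossY N)
    ≤⟨ +-mono-≤ (*-monoʳ-≤ N (line-crossings d q x₁ x₂)) (*-monoʳ-≤ N (line-crossings d q y₁ y₂)) ⟩
  N * (N * ∣ x₁ - x₂ ∣) + N * (N * ∣ y₁ - y₂ ∣)
    ≡⟨ collect N ∣ x₁ - x₂ ∣ ∣ y₁ - y₂ ∣ ⟩
  (N * N) * (∣ x₁ - x₂ ∣ + ∣ y₁ - y₂ ∣) ∎
  where
  open ≤-Reasoning
  N : ℕ
  N = q * d
  crossX crossY : ℕ → ℕ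
  crossX b = countLines d b (x₁ ⊓ x₂) (x₁ ⊔ x₂)
  crossY a = countLines d a (y₁ ⊓ y₂) (y₁ ⊔ y₂)
  distribute : ∀ d N a b → d * (N * a + N * b) ≡ N * (d * a) + N * (d * b)
  distribute = solve-∀
  collect : ∀ N a b → N * (N * a) + N * (N * b) ≡ (N * N) * (a + b)
  collect = solve-∀

Edges : (I : Instance) → Solution I → List (Point × Point)
Edges I π = concatMap (tourEdges I) π

sum-map-scale : ∀ {B : Set} d (h P : B → ℕ) → (∀ e → d * h e ≤ P e) → ∀ E → d * sum (map h E) ≤ sum (map P E)
sum-map-scale d h P le []      = ≤-reflexive (*-zeroʳ d)
sum-map-scale d h P le (e ∷ E) =
  ≤-trans (≤-reflexive (*-distribˡ-+ d (h e) _)) (+-mono-≤ (le e) (sum-map-scale d h P le E))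

crossings-bound : ∀ I (π : Solution I) ℓ → ℓ ≤ m I →
  side I ℓ * totalCrossings I π ℓ ≤ sum (map (λ e → (L I * L I) * taxicab e) (Edges I π))
crossings-bound I π ℓ ℓ≤m = begin
  d * totalCrossings I π ℓ                               ≡⟨ cong (d *_) per-edge ⟩
  d * sum (map (λ e → Sum (λ a → Sum (λ b → g a b e) N) N) E) ≤⟨ sum-map-scale d _ _ edge E ⟩
  sum (map (λ e → (N * N) * taxicab e) E)               ∎
  where
  open ≤-Reasoning
  d = side I ℓ
  N = L I
  E = Edges I π
  g : ℕ → ℕ → Point × Point → ℕ
  g a b e = segCross d a b (proj₁ e) (proj₂ e)
  N≡2^ℓ*d : N ≡ 2 ^ ℓ * d
  N≡2^ℓ*d = trans (cong (2 ^_) (sym (m+[n∸m]≡n ℓ≤m))) (^-distribˡ-+-* 2 ℓ (m I ∸ ℓ))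
  edge : ∀ e → d * Sum (λ a → Sum (λ b → g a b e) N) N ≤ (N * N) * taxicab e
  edge e rewrite N≡2^ℓ*d = edge-crossings d (2 ^ ℓ) e
  per-edge : totalCrossings I π ℓ ≡ sum (map (λ e → Sum (λ a → Sum (λ b → g a b e) N) N) E)
  per-edge = begin-equality
    Sum (λ a → Sum (λ b → crossings I π ℓ a b) N) N
      ≡⟨ Sum-cong N (λ a → Sum-cong N (λ b → cong sum (sym (map-concatMap (g a b) (tourEdges I) π)))) ⟩
    Sum (λ a → Sum (λ b → sum (map (g a b) E)) N) N
      ≡⟨ Sum-cong N (λ a → Sum-sum (λ b → g a b) E N) ⟩
    Sum (λ a → sum (map (λ e → Sum (λ b → g a b e) N) E)) N
      ≡⟨ Sum-sum (λ a e → Sum (λ b → g a b e) N) E N ⟩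
    sum (map (λ e → Sum (λ a → Sum (λ b → g a b e) N) N) E) ∎

-- (a + b)² ≤ 4·(a² + b²), through the larger of a and b
sq-of-sum : ∀ a b → (a + b) * (a + b) ≤ 4 * (a * a + b * b)
sq-of-sum a b = begin
  (a + b) * (a + b) ≤⟨ *-mono-≤ a+b≤2w a+b≤2w ⟩
  (w + w) * (w + w) ≡⟨ double w ⟩
  4 * (w * w)       ≤⟨ *-monoʳ-≤ 4 w²≤ ⟩
  4 * (a * a + b * b) ∎
  where
  open ≤-Reasoning
  w = a ⊔ b
  a+b≤2w : a + b ≤ w + w
  a+b≤2w = +-mono-≤ (m≤m⊔n a b) (m≤n⊔m a b)
  double : ∀ x → (x + x) * (x + x) ≡ 4 * (x * x)
  double = solve-∀
  w²≤ : w * w ≤ a * a + b * b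
  w²≤ with ⊔-sel a b
  ... | inj₁ w≡a rewrite w≡a = m≤m+n (a * a) (b * b)
  ... | inj₂ w≡b rewrite w≡b = m≤n+m (b * b) (a * a)

scaled-taxicab : ∀ M e → (M * taxicab e) * (M * taxicab e) ≤ ((2 * M) * (2 * M)) * sqDist (proj₁ e) (proj₂ e)
scaled-taxicab M ((x₁ , y₁) , (x₂ , y₂)) = begin
  (M * (a + b)) * (M * (a + b))         ≡⟨ factor M (a + b) ⟩
  (M * M) * ((a + b) * (a + b))         ≤⟨ *-monoʳ-≤ (M * M) (sq-of-sum a b) ⟩
  (M * M) * (4 * (a * a + b * b))       ≡⟨ absorb M (a * a + b * b) ⟩
  ((2 * M) * (2 * M)) * (a * a + b * b) ∎
  where
  open ≤-Reasoning
  a = ∣ x₁ - x₂ ∣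
  b = ∣ y₁ - y₂ ∣
  factor : ∀ m s → (m * s) * (m * s) ≡ (m * m) * (s * s)
  factor = solve-∀
  absorb : ∀ m s → (m * m) * (4 * s) ≡ ((2 * m) * (2 * m)) * s
  absorb = solve-∀

coprime-1 : ∀ a → Coprime a 1
coprime-1 a (_ , i∣1) = ∣1⇒≡1 i∣1

ℕ→ℚ≡mkℚ : ∀ a → ℕ→ℚ a ≡ ℚ.mkℚ (ℤ.+ a) 0 (coprime-1 a)
ℕ→ℚ≡mkℚ a = ℚP.normalize-coprime (coprime-1 a)

ℕ→ℚ-+ : ∀ a b → ℕ→ℚ (a + b) ≡ ℕ→ℚ a ℚ.+ ℕ→ℚ b
ℕ→ℚ-+ a b rewrite ℕ→ℚ≡mkℚ a | ℕ→ℚ≡mkℚ b =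
  cong (ℚ._/ 1) (sym (trans (cong₂ ℤ._+_ (ℤP.*-identityʳ (ℤ.+ a)) (ℤP.*-identityʳ (ℤ.+ b))) (sym (ℤP.pos-+ a b))))

ℕ→ℚ-* : ∀ a b → ℕ→ℚ (a * b) ≡ ℕ→ℚ a ℚ.* ℕ→ℚ b
ℕ→ℚ-* a b rewrite ℕ→ℚ≡mkℚ a | ℕ→ℚ≡mkℚ b = cong (ℚ._/ 1) (ℤP.pos-* a b)

ℕ→ℚ-mono : ∀ {a b} → a ≤ b → ℕ→ℚ a ℚ.≤ ℕ→ℚ b
ℕ→ℚ-mono {a} {b} a≤b rewrite ℕ→ℚ≡mkℚ a | ℕ→ℚ≡mkℚ b =
  ℚ.*≤* (subst₂ ℤ._≤_ (sym (ℤP.*-identityʳ (ℤ.+ a))) (sym (ℤP.*-identityʳ (ℤ.+ b))) (ℤ.+≤+ a≤b))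

ℕ→ℚ-nonneg : ∀ a → ℚ.0ℚ ℚ.≤ ℕ→ℚ a
ℕ→ℚ-nonneg a = ℕ→ℚ-mono {0} {a} z≤n

sumℚ-ℕ→ℚ : ∀ xs → sumℚ (map ℕ→ℚ xs) ≡ ℕ→ℚ (sum xs)
sumℚ-ℕ→ℚ []       = refl
sumℚ-ℕ→ℚ (x ∷ xs) = trans (cong (ℕ→ℚ x ℚ.+_) (sumℚ-ℕ→ℚ xs)) (sym (ℕ→ℚ-+ x (sum xs)))

lowerRoots : ∀ {ps ys} → Pointwise (λ p y → p * p ≤ y) ps ys → Pointwise LowerRoot (map ℕ→ℚ ps) ys
lowerRoots []                   = []
lowerRoots {p ∷ _} (p²≤y ∷ rest) =
  (ℕ→ℚ-nonneg p , ℚP.≤-trans (ℚP.≤-reflexive (sym (ℕ→ℚ-* p p))) (ℕ→ℚ-mono p²≤y)) ∷ lowerRoots rest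

square-≤√ : ∀ x ps ys → x ≤ sum ps → Pointwise (λ p y → p * p ≤ y) ps ys → (x * x ∷ []) ≤√ ys
square-≤√ x ps ys x≤Σps roots ε ε>0 =
  ℕ→ℚ x ∷ [] , map ℕ→ℚ ps ,
  ((ℕ→ℚ-nonneg x , ℚP.≤-reflexive (ℕ→ℚ-* x x)) ∷ []) , lowerRoots roots ,
  (begin
    ℕ→ℚ x ℚ.+ ℚ.0ℚ               ≡⟨ ℚP.+-identityʳ (ℕ→ℚ x) ⟩
    ℕ→ℚ x                        ≤⟨ ℕ→ℚ-mono x≤Σps ⟩
    ℕ→ℚ (sum ps)                 ≡⟨ sym (sumℚ-ℕ→ℚ ps) ⟩
    sumℚ (map ℕ→ℚ ps)            ≡⟨ sym (ℚP.+-identityʳ _) ⟩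
    sumℚ (map ℕ→ℚ ps) ℚ.+ ℚ.0ℚ   ≤⟨ ℚP.+-monoʳ-≤ (sumℚ (map ℕ→ℚ ps)) (ℚP.<⇒≤ ε>0) ⟩
    sumℚ (map ℕ→ℚ ps) ℚ.+ ε      ∎)
  where open ℚP.≤-Reasoning

pointwise-map : ∀ {A B C : Set} {R : B → C → Set} (f : A → B) (g : A → C) →
  (∀ a → R (f a) (g a)) → ∀ xs → Pointwise R (map f xs) (map g xs)
pointwise-map f g r []       = []
pointwise-map f g r (x ∷ xs) = r x ∷ pointwise-map f g r xs

edge-lowerRoots : ∀ I (π : Solution I) →
  Pointwise (λ p y → p * p ≤ y) (map (λ e → (L I * L I) * taxicab e) (Edges I π))
    (map (λ s → ((2 * (L I * L I)) * (2 * (L I * L I))) * s) (lengthRS I π))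
edge-lowerRoots I π =
  subst (Pointwise _ (map (λ e → M * taxicab e) E))
        (trans (map-∘ E) (cong (map (((2 * M) * (2 * M)) *_)) (map-concatMap sqLength (tourEdges I) π)))
        (pointwise-map _ _ (scaled-taxicab M) E)
  where
  M = L I * L I
  E = Edges I π
  sqLength : Point × Point → ℕ
  sqLength e = sqDist (proj₁ e) (proj₂ e)

lemma4 : Σ ℕ (λ C → (I : Instance) → WellFormed I → (π : Solution I) → Optimal I π →
    (ℓ : ℕ) → ℓ ≤ m I →
    ((side I ℓ * totalCrossings I π ℓ) * (side I ℓ * totalCrossings I π ℓ) ∷ [])
    ≤√ map (λ s → ((C * (L I * L I)) * (C * (L I * L I))) * s) (lengthRS I π))
lemma4 = 2 , λ I _ π _ ℓ ℓ≤m →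
  square-≤√ (side I ℓ * totalCrossings I π ℓ) _ _ (crossings-bound I π ℓ ℓ≤m) (edge-lowerRoots I π)
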